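{- A finite reflexive graph $G$ contains an invertible pair if and only if it contains a weak edge-asteroid.
   Context: A reflexive graph has a loop at every vertex; $E(G)$ includes all loops. A walk is a sequence of vertices $w_0\dots w_t$ with $w_jw_{j+1}\in E(G)$; its edges are the $w_jw_{j+1}$. Let $Z(G)$ be the set of ordered pairs of distinct vertices. For $(u,v),(u',v')\in Z(G)$, $(u,v)\Lambda(u',v')$ if either $u=u'$ and $v=v'$, or $uu',vv'\in E(G)$ and $uv',vu'\notin E(G)$. Write $(u,v)\sim(u',v')$ if there exist walks $u_1\dots u_k$ and $v_1\dots v_k$ with $(u_1,v_1)=(u,v)$, $(u_k,v_k)=(u',v')$, all $(u_i,v_i)\in Z(G)$, and $(u_i,v_i)\Lambda(u_{i+1},v_{i+1})$ for each $i$. An invertible pair is a pair of distinct vertices $u,v$ with $(u,v)\sim(v,u)$. For edges $uu',vv'$ (possibly loops) with $\{u,u'\}\cap\{v,v'\}=\emptyset$, $uu'$ avoids $vv'$ if: (i) $u=u'$, $v=v'$, $uv\notin E(G)$; or (ii) $u=u'$, $v\neq v'$, $uv,uv'\notin E(G)$; or (iii) $u\ne u'$, $v=v'$, $uv,u'v\notin E(G)$; or (iv) $u\ne u'$, $v\ne v'$ and $\{u,u',v,v'\}$ induces $2K_2$, $P_4$ or $C_4$. An edge avoids a walk if it avoids every edge of it. A weak edge-asteroid is a set of edges $x_0y_0,\dots,x_{2k}y_{2k}$ ($k\ge0$) such that for each $i$, $x_iy_i$ avoids some walk whose first edge is $x_{i+k}y_{i+k}$ and whose last edge is $x_{i+k+1}y_{i+k+1}$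 (indices mod $2k+1$). -}

module Defs where

open import Data.Nat using (ℕ; suc; _+_; _*_)
open import Data.Fin using (Fin; toℕ; fromℕ<)
open import Data.Fin.Properties using ()
open import Data.Nat.DivMod using (_%_; m%n<n)
open import Data.List using (List; []; _∷_)
open import Data.Product using (Σ; ∃; ∃-syntax; _×_; _,_)
open import Data.Sum using (_⊎_)
open import Relation.Nullary using (¬_; Dec)
open import Relation.Binary.PropositionalEquality using (_≡_; _≢_)
open import Relation.Binary.Definitions using (Decidable)

record ReflGraph : Set₁ where
  field
    n     : ℕ
    Adj   : Fin n → Fin n → Set
    adj?  : Decidable Adj
    refl  : ∀ x → Adj x x
    sym   : ∀ {x y} → Adj x y → Adj y x

module _ (G : ReflGraph) where
  open ReflGraph G

  V : Set
  V = Fin n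

  Λ : V × V → V × V → Set
  Λ (u , v) (u' , v') =
    (u ≡ u' × v ≡ v') ⊎ (Adj u u' × Adj v v' × ¬ Adj u v' × ¬ Adj v u')

  data Chain : V × V → V × V → Set where
    done : ∀ {u v} → u ≢ v → Chain (u , v) (u , v)
    step : ∀ {u v u' v' p} → u ≢ v → Adj u u' → Adj v v' →
           Λ (u , v) (u' , v') → Chain (u' , v') p → Chain (u , v) p

  _∼_ : V × V → V × V → Set
  p ∼ q = Chain p q

  InvertiblePair : V → V → Set
  InvertiblePair u v = u ≢ v × (u , v) ∼ (v , u)

  HasInvertiblePair : Set
  HasInvertiblePair = ∃[ u ] ∃[ v ] InvertiblePair u v

  Edge : Set
  Edge = Σ (V × V) (λ { (x , y) → Adj x y })

  Avoids : V × V → V × V → Set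
  Avoids (u , u') (v , v') =
    u ≢ v × u ≢ v' × u' ≢ v × u' ≢ v' ×
    (  (u ≡ u' × v ≡ v' × ¬ Adj u v)
    ⊎ (u ≡ u' × v ≢ v' × ¬ Adj u v × ¬ Adj u v')
    ⊎ (u ≢ u' × v ≡ v' × ¬ Adj u v × ¬ Adj u' v)
    ⊎ (u ≢ u' × v ≢ v' × Induces2K2-P4-C4))
    where
    -- {u,u',v,v'} are four distinct vertices with uu', vv' ∈ E(G);
    -- the induced subgraph is 2K2, P4 or C4 iff the set of "cross" edges
    -- among uv, uv', u'v, u'v' is: empty (2K2), a single one (P4),
    -- or {uv, u'v'} or {uv', u'v} (C4).
    Induces2K2-P4-C4 : Set
    Induces2K2-P4-C4 =
        (¬ Adj u v × ¬ Adj u v' × ¬ Adj u' v × ¬ Adj u' v')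
      ⊎ (  Adj u v × ¬ Adj u v' × ¬ Adj u' v × ¬ Adj u' v')
      ⊎ (¬ Adj u v ×   Adj u v' × ¬ Adj u' v × ¬ Adj u' v')
      ⊎ (¬ Adj u v × ¬ Adj u v' ×   Adj u' v × ¬ Adj u' v')
      ⊎ (¬ Adj u v × ¬ Adj u v' × ¬ Adj u' v ×   Adj u' v')
      ⊎ (  Adj u v × ¬ Adj u v' × ¬ Adj u' v ×   Adj u' v')
      ⊎ (¬ Adj u v ×   Adj u v' ×   Adj u' v × ¬ Adj u' v')

  -- A walk with at least one edge, whose first edge is (x , y) and whose
  -- last edge is (x' , y'); carries the property that the edge e avoids
  -- every edge of the walk.
  data WalkAvoiding (e : V × V) : V × V → V × V → Set where
    one  : ∀ {x y} → Adj x y → Avoids e (x , y) →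
           WalkAvoiding e (x , y) (x , y)
    more : ∀ {x y z q} → Adj x y → Avoids e (x , y) →
           WalkAvoiding e (y , z) q → WalkAvoiding e (x , y) q

  _⊕_ : ∀ {m} → Fin (suc m) → ℕ → Fin (suc m)
  _⊕_ {m} i j = fromℕ< (m%n<n (toℕ i + j) (suc m))

  record WeakEdgeAsteroid : Set where
    field
      k     : ℕ
      edge  : Fin (suc (2 * k)) → V × V
      isEdge : ∀ i → let (x , y) = edge i in Adj x y
      avoid : ∀ i → WalkAvoiding (edge i) (edge (i ⊕ k)) (edge (i ⊕ suc k))

  HasWeakEdgeAsteroid : Set
  HasWeakEdgeAsteroid = WeakEdgeAsteroid

-- (⇒) Dropping the identity steps of (u , v) ∼ (v , u) leaves strict Λ-steps p₀ → … → p_T with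
-- p_T = swap p₀; continued antiperiodically (p_{s+T} = swap p_s) their first coordinates a_s form a
-- closed walk of length 2T. Each edge a_s a_{s+1} avoids the three consecutive edges of this walk
-- from a_{s+T-1} to a_{s+T+2}, so the 2T+1 edges a_0 a_1, …, a_{2T} a_{2T+1} (the last one repeating
-- the first) form a weak edge-asteroid with k = T.
--
-- (⇐) For an edge xy and a vertex w, call (z , w) admissible when z ∈ {x , y}, z ≠ w, and z is adjacent
-- to w or w is adjacent to neither of x, y. Along a walk avoided by xy all admissible pairs lie in one
-- ∼-class. In a weak edge-asteroid the walk of edge i ends at edge i+k+1, whose walk starts at edge i;
-- a pair crossing between these two edges shows that the class of edge i is the reverse of the class
-- of edge i+k+1. Going around twice, all classes coincide, so the class of edge 0 contains both some
-- (u , v) and (v , u).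

{-# OPTIONS --safe #-}
module Submission where

open import Defs
open import Data.Product using (Σ-syntax; _×_; _,_; proj₁; proj₂; swap; map₂)
open import Data.Sum using (_⊎_; inj₁; inj₂)
open import Data.Bool using (Bool; true; false; not; if_then_else_)
open import Data.Nat using (ℕ; zero; suc; _+_; _*_; _∸_; _<_; _≤_; z≤n; s≤s; _<?_)
open import Data.Nat.Properties
  using ( +-identityʳ; +-assoc; +-suc; +-monoˡ-≤; +-monoʳ-≤; m≤m+n; m∸n+n≡m; ≤-refl; ≤-trans; ≤-antisym
        ; <⇒≤; <-trans; ≤-<-trans; <-cmp; ≮⇒≥; n<1+n; <-irrefl)
open import Data.Nat.DivMod using (_%_; %-distribˡ-+; m%n%n≡m%n; [m+n]%n≡m%n; m<n⇒m%n≡m; n%n≡0)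
open import Data.Nat.Tactic.RingSolver using (solve-∀)
open import Data.Fin using (Fin; toℕ) renaming (zero to fzero)
open import Data.Fin.Properties using (toℕ-fromℕ<; toℕ-injective; toℕ<n) renaming (_≟_ to _≟ᶠ_)
open import Data.Empty using (⊥-elim)
open import Relation.Nullary using (¬_; Dec; yes; no)
open import Relation.Binary.Definitions using (tri<; tri≈; tri>)
open import Relation.Binary.PropositionalEquality
  using (_≡_; _≢_; refl; sym; trans; cong; cong₂; subst; subst₂; module ≡-Reasoning)

WithinDiagonal : Set → Set → Set → Set → Set
WithinDiagonal A B C D = ¬ (A × B) × ¬ (C × D) × ¬ (A × C) × ¬ (B × D)

-- The truth patterns of (uv, uv', u'v, u'v') for which {u, u', v, v'} induces 2K₂, P₄ or C₄.
CrossPattern : Set → Set → Set → Set → Set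
CrossPattern A B C D =
    (¬ A × ¬ B × ¬ C × ¬ D)
  ⊎ (  A × ¬ B × ¬ C × ¬ D)
  ⊎ (¬ A ×   B × ¬ C × ¬ D)
  ⊎ (¬ A × ¬ B ×   C × ¬ D)
  ⊎ (¬ A × ¬ B × ¬ C ×   D)
  ⊎ (  A × ¬ B × ¬ C ×   D)
  ⊎ (¬ A ×   B ×   C × ¬ D)

module _ {A B C D : Set} where

  within-of-¬A¬D : ¬ A → ¬ D → WithinDiagonal A B C D
  within-of-¬A¬D ¬a ¬d =
    (λ p → ¬a (proj₁ p)) , (λ p → ¬d (proj₂ p)) , (λ p → ¬a (proj₁ p)) , (λ p → ¬d (proj₂ p))

  within-of-¬B¬C : ¬ B → ¬ C → WithinDiagonal A B C D
  within-of-¬B¬C ¬b ¬c =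
    (λ p → ¬b (proj₂ p)) , (λ p → ¬c (proj₁ p)) , (λ p → ¬c (proj₂ p)) , (λ p → ¬b (proj₁ p))

  crossPattern⇒within : CrossPattern A B C D → WithinDiagonal A B C D
  crossPattern⇒within (inj₁ (¬a , _ , _ , ¬d)) = within-of-¬A¬D ¬a ¬d
  crossPattern⇒within (inj₂ (inj₁ (_ , ¬b , ¬c , _))) = within-of-¬B¬C ¬b ¬c
  crossPattern⇒within (inj₂ (inj₂ (inj₁ (¬a , _ , _ , ¬d)))) = within-of-¬A¬D ¬a ¬d
  crossPattern⇒within (inj₂ (inj₂ (inj₂ (inj₁ (¬a , _ , _ , ¬d))))) = within-of-¬A¬D ¬a ¬d
  crossPattern⇒within (inj₂ (inj₂ (inj₂ (inj₂ (inj₁ (_ , ¬b , ¬c , _)))))) = within-of-¬B¬C ¬b ¬c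
  crossPattern⇒within (inj₂ (inj₂ (inj₂ (inj₂ (inj₂ (inj₁ (_ , ¬b , ¬c , _))))))) = within-of-¬B¬C ¬b ¬c
  crossPattern⇒within (inj₂ (inj₂ (inj₂ (inj₂ (inj₂ (inj₂ (¬a , _ , _ , ¬d))))))) = within-of-¬A¬D ¬a ¬d

  within⇒crossPattern : Dec A → Dec B → Dec C → Dec D → WithinDiagonal A B C D → CrossPattern A B C D
  within⇒crossPattern (no ¬a) (no ¬b) (no ¬c) (no ¬d) _ = inj₁ (¬a , ¬b , ¬c , ¬d)
  within⇒crossPattern (yes a) (no ¬b) (no ¬c) (no ¬d) _ = inj₂ (inj₁ (a , ¬b , ¬c , ¬d))
  within⇒crossPattern (no ¬a) (yes b) (no ¬c) (no ¬d) _ = inj₂ (inj₂ (inj₁ (¬a , b , ¬c , ¬d)))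
  within⇒crossPattern (no ¬a) (no ¬b) (yes c) (no ¬d) _ = inj₂ (inj₂ (inj₂ (inj₁ (¬a , ¬b , c , ¬d))))
  within⇒crossPattern (no ¬a) (no ¬b) (no ¬c) (yes d) _ = inj₂ (inj₂ (inj₂ (inj₂ (inj₁ (¬a , ¬b , ¬c , d)))))
  within⇒crossPattern (yes a) (no ¬b) (no ¬c) (yes d) _ = inj₂ (inj₂ (inj₂ (inj₂ (inj₂ (inj₁ (a , ¬b , ¬c , d))))))
  within⇒crossPattern (no ¬a) (yes b) (yes c) (no ¬d) _ = inj₂ (inj₂ (inj₂ (inj₂ (inj₂ (inj₂ (¬a , b , c , ¬d))))))
  within⇒crossPattern (yes a) (yes b) _ _ (¬ab , _) = ⊥-elim (¬ab (a , b))
  within⇒crossPattern _ _ (yes c) (yes d) (_ , ¬cd , _) = ⊥-elim (¬cd (c , d))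
  within⇒crossPattern (yes a) _ (yes c) _ (_ , _ , ¬ac , _) = ⊥-elim (¬ac (a , c))
  within⇒crossPattern _ (yes b) _ (yes d) (_ , _ , _ , ¬bd) = ⊥-elim (¬bd (b , d))

module _ (G : ReflGraph) where
  open ReflGraph G renaming (refl to adj-refl; sym to adj-sym)

  Pair : Set
  Pair = V G × V G

  ¬adj-sym : ∀ {u v} → ¬ Adj u v → ¬ Adj v u
  ¬adj-sym ¬uv vu = ¬uv (adj-sym vu)

  -- Avoidance between edges in symmetric form, without the case distinction on loops.
  Separated : Pair → Pair → Set
  Separated (u , u') (v , v') =
    u ≢ v × u ≢ v' × u' ≢ v × u' ≢ v' × WithinDiagonal (Adj u v) (Adj u v') (Adj u' v) (Adj u' v')

  avoids⇒separated : ∀ {e f} → Avoids G e f → Separated e f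
  avoids⇒separated (d₁ , d₂ , d₃ , d₄ , inj₁ (refl , refl , ¬uv)) =
    d₁ , d₂ , d₃ , d₄ , within-of-¬A¬D ¬uv ¬uv
  avoids⇒separated (d₁ , d₂ , d₃ , d₄ , inj₂ (inj₁ (refl , _ , ¬uv , ¬uv'))) =
    d₁ , d₂ , d₃ , d₄ , within-of-¬A¬D ¬uv ¬uv'
  avoids⇒separated (d₁ , d₂ , d₃ , d₄ , inj₂ (inj₂ (inj₁ (_ , refl , ¬uv , ¬u'v)))) =
    d₁ , d₂ , d₃ , d₄ , within-of-¬A¬D ¬uv ¬u'v
  avoids⇒separated (d₁ , d₂ , d₃ , d₄ , inj₂ (inj₂ (inj₂ (_ , _ , induced)))) =
    d₁ , d₂ , d₃ , d₄ , crossPattern⇒within induced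

  separated⇒avoids : ∀ {u u' v v'} → Separated (u , u') (v , v') → Avoids G (u , u') (v , v')
  separated⇒avoids {u} {u'} {v} {v'} (d₁ , d₂ , d₃ , d₄ , w@(¬uv-uv' , ¬u'v-u'v' , ¬uv-u'v , ¬uv'-u'v'))
    with u ≟ᶠ u' | v ≟ᶠ v'
  ... | yes refl | yes refl = d₁ , d₂ , d₃ , d₄ , inj₁ (refl , refl , λ a → ¬uv-uv' (a , a))
  ... | yes refl | no v≢v' =
    d₁ , d₂ , d₃ , d₄ , inj₂ (inj₁ (refl , v≢v' , (λ a → ¬uv-u'v (a , a)) , λ a → ¬uv'-u'v' (a , a)))
  ... | no u≢u' | yes refl =
    d₁ , d₂ , d₃ , d₄ , inj₂ (inj₂ (inj₁ (u≢u' , refl , (λ a → ¬uv-uv' (a , a)) , λ a → ¬u'v-u'v' (a , a))))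
  ... | no u≢u' | no v≢v' =
    d₁ , d₂ , d₃ , d₄ , inj₂ (inj₂ (inj₂ (u≢u' , v≢v' ,
      within⇒crossPattern (adj? u v) (adj? u v') (adj? u' v) (adj? u' v') w)))

  separated-of-¬diagonals : ∀ {u u' v v'} → Adj u u' → Adj v v' → ¬ Adj u v' → ¬ Adj u' v →
                            Separated (u , u') (v , v')
  separated-of-¬diagonals {u} {u'} uu' vv' ¬uv' ¬u'v =
    (λ { refl → ¬uv' vv' }) , (λ { refl → ¬uv' (adj-refl u) }) ,
    (λ { refl → ¬u'v (adj-refl u') }) , (λ { refl → ¬uv' uu' }) ,
    within-of-¬B¬C ¬uv' ¬u'v

  separated-flip : ∀ {u u' v v'} → Separated (u , u') (v' , v) → Separated (u , u') (v , v')
  separated-flip (d₁ , d₂ , d₃ , d₄ , ¬uv'-uv , ¬u'v'-u'v , ¬uv'-u'v' , ¬uv-u'v) =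
    d₂ , d₁ , d₄ , d₃ , swap-¬ ¬uv'-uv , swap-¬ ¬u'v'-u'v , ¬uv-u'v , ¬uv'-u'v'
    where
    swap-¬ : ∀ {P Q : Set} → ¬ (P × Q) → ¬ (Q × P)
    swap-¬ ¬pq qp = ¬pq (swap qp)

  separated-of-¬parallels : ∀ {u u' v v'} → Adj u u' → Adj v v' → ¬ Adj u v → ¬ Adj u' v' →
                            Separated (u , u') (v , v')
  separated-of-¬parallels uu' vv' ¬uv ¬u'v' =
    separated-flip (separated-of-¬diagonals uu' (adj-sym vv') ¬uv ¬u'v')

  chain-trans : ∀ {p q r} → Chain G p q → Chain G q r → Chain G p r
  chain-trans (done _) c = c
  chain-trans (step u≢v uu' vv' l c) c' = step u≢v uu' vv' l (chain-trans c c')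

  chain-source≢ : ∀ {u v q} → Chain G (u , v) q → u ≢ v
  chain-source≢ (done u≢v) = u≢v
  chain-source≢ (step u≢v _ _ _ _) = u≢v

  Λ-sym : ∀ {p q} → Λ G p q → Λ G q p
  Λ-sym (inj₁ (refl , refl)) = inj₁ (refl , refl)
  Λ-sym (inj₂ (uu' , vv' , ¬uv' , ¬vu')) =
    inj₂ (adj-sym uu' , adj-sym vv' , ¬adj-sym ¬vu' , ¬adj-sym ¬uv')

  chain-sym : ∀ {p q} → Chain G p q → Chain G q p
  chain-sym (done u≢v) = done u≢v
  chain-sym (step u≢v uu' vv' l c) =
    chain-trans (chain-sym c) (step (chain-source≢ c) (adj-sym uu') (adj-sym vv') (Λ-sym l) (done u≢v))

  Λ-swap : ∀ {p q} → Λ G p q → Λ G (swap p) (swap q)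
  Λ-swap (inj₁ (refl , refl)) = inj₁ (refl , refl)
  Λ-swap (inj₂ (uu' , vv' , ¬uv' , ¬vu')) = inj₂ (vv' , uu' , ¬vu' , ¬uv')

  chain-swap : ∀ {p q} → Chain G p q → Chain G (swap p) (swap q)
  chain-swap (done u≢v) = done (λ v≡u → u≢v (sym v≡u))
  chain-swap (step u≢v uu' vv' l c) = step (λ v≡u → u≢v (sym v≡u)) vv' uu' (Λ-swap l) (chain-swap c)

  Λ-step : ∀ {u v u' v'} → u ≢ v → u' ≢ v' → Adj u u' → Adj v v' → ¬ Adj u v' → ¬ Adj v u' →
           Chain G (u , v) (u' , v')
  Λ-step u≢v u'≢v' uu' vv' ¬uv' ¬vu' = step u≢v uu' vv' (inj₂ (uu' , vv' , ¬uv' , ¬vu')) (done u'≢v')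

  head-avoided : ∀ {e p q} → WalkAvoiding G e p q → Avoids G e p
  head-avoided (one _ av) = av
  head-avoided (more _ av _) = av

  last-avoided : ∀ {e p q} → WalkAvoiding G e p q → Avoids G e q
  last-avoided (one _ av) = av
  last-avoided (more _ _ W) = last-avoided W

  _∈ₑ_ : V G → Pair → Set
  w ∈ₑ (c , d) = w ≡ c ⊎ w ≡ d

  Sees : Pair → V G → V G → Set
  Sees (x , y) z w = Adj z w ⊎ (¬ Adj x w × ¬ Adj y w)

  Admissible : Pair → V G → V G → Set
  Admissible e z w = z ∈ₑ e × z ≢ w × Sees e z w

  Linked : Pair → V G → V G → Set
  Linked e w w' = ∀ {z z'} → Admissible e z w → Admissible e z' w' → Chain G (z , w) (z' , w')

  admissible-exists : ∀ {x y w} → x ≢ w → y ≢ w → Σ[ z ∈ V G ] Admissible (x , y) z w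
  admissible-exists {x} {y} {w} x≢w y≢w with adj? x w | adj? y w
  ... | yes xw | _      = x , inj₁ refl , x≢w , inj₁ xw
  ... | no _   | yes yw = y , inj₂ refl , y≢w , inj₁ yw
  ... | no ¬xw | no ¬yw = x , inj₁ refl , x≢w , inj₂ (¬xw , ¬yw)

  adjacent-admissible : ∀ {e f z z'} → z ∈ₑ e → z' ∈ₑ f → z ≢ z' → Adj z z' →
                        Admissible e z z' × Admissible f z' z
  adjacent-admissible z∈e z'∈f z≢z' zz' =
    (z∈e , z≢z' , inj₁ zz') , (z'∈f , (λ z'≡z → z≢z' (sym z'≡z)) , inj₁ (adj-sym zz'))

  linked-sym : ∀ {e w w'} → Linked e w w' → Linked e w' w
  linked-sym L a a' = chain-sym (L a' a)

  linked-trans : ∀ {x y w w' w''} → x ≢ w' → y ≢ w' →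
                 Linked (x , y) w w' → Linked (x , y) w' w'' → Linked (x , y) w w''
  linked-trans x≢w' y≢w' L L' a a'' with admissible-exists x≢w' y≢w'
  ... | _ , a' = chain-trans (L a a') (L' a' a'')

  sees-x : ∀ {x y w} → ¬ Adj y w → Sees (x , y) x w
  sees-x {x} {w = w} ¬yw with adj? x w
  ... | yes xw = inj₁ xw
  ... | no ¬xw = inj₂ (¬xw , ¬yw)

  sees-y : ∀ {x y w} → ¬ Adj x w → Sees (x , y) y w
  sees-y {y = y} {w} ¬xw with adj? y w
  ... | yes yw = inj₁ yw
  ... | no ¬yw = inj₂ (¬xw , ¬yw)

  sees-neither : ∀ {x y w} → ¬ (Adj x w × Adj y w) → Sees (x , y) x w → Sees (x , y) y w →
                 ¬ Adj x w × ¬ Adj y w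
  sees-neither _ (inj₂ ¬xw-¬yw) _ = ¬xw-¬yw
  sees-neither ¬both (inj₁ xw) (inj₁ yw) = ⊥-elim (¬both (xw , yw))
  sees-neither _ (inj₁ xw) (inj₂ (¬xw , _)) = ⊥-elim (¬xw xw)

  module _ {x y : V G} (xy : Adj x y) where

    vertex-linked : ∀ {w} → ¬ (Adj x w × Adj y w) → Linked (x , y) w w
    vertex-linked _ (inj₁ refl , z≢w , _) (inj₁ refl , _) = done z≢w
    vertex-linked _ (inj₂ refl , z≢w , _) (inj₂ refl , _) = done z≢w
    vertex-linked ¬both (inj₁ refl , x≢w , sx) (inj₂ refl , y≢w , sy) with sees-neither ¬both sx sy
    ... | ¬xw , ¬yw = Λ-step x≢w y≢w xy (adj-refl _) ¬xw (¬adj-sym ¬yw)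
    vertex-linked ¬both (inj₂ refl , y≢w , sy) (inj₁ refl , x≢w , sx) with sees-neither ¬both sx sy
    ... | ¬xw , ¬yw = Λ-step y≢w x≢w (adj-sym xy) (adj-refl _) ¬yw (¬adj-sym ¬xw)

    linked-via : ∀ {v v' z₀ z₀'} → ¬ (Adj x v × Adj y v) → ¬ (Adj x v' × Adj y v') →
                 Admissible (x , y) z₀ v → Admissible (x , y) z₀' v' → Chain G (z₀ , v) (z₀' , v') →
                 Linked (x , y) v v'
    linked-via ¬both-v ¬both-v' b b' c a a' =
      chain-trans (vertex-linked ¬both-v a b) (chain-trans c (vertex-linked ¬both-v' b' a'))

    linked-by-xy-step : ∀ {v v'} → Adj v v' → Separated (x , y) (v , v') → ¬ Adj x v' → ¬ Adj y v →
                        Linked (x , y) v v'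
    linked-by-xy-step vv' (x≢v , _ , _ , y≢v' , _ , _ , ¬v-xy , ¬v'-xy) ¬xv' ¬yv =
      linked-via ¬v-xy ¬v'-xy (inj₁ refl , x≢v , sees-x ¬yv) (inj₂ refl , y≢v' , sees-y ¬xv')
        (Λ-step x≢v y≢v' xy vv' ¬xv' (¬adj-sym ¬yv))

    linked-by-yx-step : ∀ {v v'} → Adj v v' → Separated (x , y) (v , v') → ¬ Adj y v' → ¬ Adj x v →
                        Linked (x , y) v v'
    linked-by-yx-step vv' (_ , x≢v' , y≢v , _ , _ , _ , ¬v-xy , ¬v'-xy) ¬yv' ¬xv =
      linked-via ¬v-xy ¬v'-xy (inj₂ refl , y≢v , sees-y ¬xv) (inj₁ refl , x≢v' , sees-x ¬yv')
        (Λ-step y≢v x≢v' (adj-sym xy) vv' ¬yv' (¬adj-sym ¬xv))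

    -- One of the two single Λ-steps always applies: each way both can fail contradicts separation.
    separated-edge-linked : ∀ {v v'} → Adj v v' → Separated (x , y) (v , v') → Linked (x , y) v v'
    separated-edge-linked {v} {v'} vv' sep@(_ , _ , _ , _ , ¬x-vv' , ¬y-vv' , ¬v-xy , ¬v'-xy)
      with adj? x v' | adj? y v
    ... | no ¬xv' | no ¬yv = linked-by-xy-step vv' sep ¬xv' ¬yv
    ... | yes xv' | _      = linked-by-yx-step vv' sep (λ yv' → ¬v'-xy (xv' , yv')) (λ xv → ¬x-vv' (xv , xv'))
    ... | no _    | yes yv = linked-by-yx-step vv' sep (λ yv' → ¬y-vv' (yv , yv')) (λ xv → ¬v-xy (xv , yv))

    edge-linked : ∀ {v v' w w'} → Adj v v' → Separated (x , y) (v , v') → w ∈ₑ (v , v') → w' ∈ₑ (v , v') →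
                  Linked (x , y) w w'
    edge-linked _ (_ , _ , _ , _ , _ , _ , ¬v-xy , _) (inj₁ refl) (inj₁ refl) = vertex-linked ¬v-xy
    edge-linked vv' sep (inj₁ refl) (inj₂ refl) = separated-edge-linked vv' sep
    edge-linked vv' sep (inj₂ refl) (inj₁ refl) = linked-sym (separated-edge-linked vv' sep)
    edge-linked _ (_ , _ , _ , _ , _ , _ , _ , ¬v'-xy) (inj₂ refl) (inj₂ refl) = vertex-linked ¬v'-xy

    head-linked : ∀ {p q w w'} → WalkAvoiding G (x , y) p q → w ∈ₑ p → w' ∈ₑ p → Linked (x , y) w w'
    head-linked (one vv' av) = edge-linked vv' (avoids⇒separated av)
    head-linked (more vv' av _) = edge-linked vv' (avoids⇒separated av)

    walk-linked : ∀ {p q w w'} → WalkAvoiding G (x , y) p q → w ∈ₑ p → w' ∈ₑ q → Linked (x , y) w w'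
    walk-linked (one vv' av) = edge-linked vv' (avoids⇒separated av)
    walk-linked (more vv' av W) w∈p w'∈q with avoids⇒separated av
    ... | sep@(_ , x≢v' , _ , y≢v' , _) =
      linked-trans x≢v' y≢v' (edge-linked vv' sep w∈p (inj₂ refl)) (walk-linked W (inj₁ refl) w'∈q)

  crossing-pair : ∀ {x y c d} → Separated (x , y) (c , d) →
                  Σ[ z ∈ V G ] Σ[ z' ∈ V G ] Admissible (x , y) z z' × Admissible (c , d) z' z
  crossing-pair {x} {y} {c} {d} (x≢c , x≢d , y≢c , y≢d , _) with adj? x c | adj? x d | adj? y c | adj? y d
  ... | yes xc | _      | _      | _      = x , c , adjacent-admissible (inj₁ refl) (inj₁ refl) x≢c xc
  ... | no _   | yes xd | _      | _      = x , d , adjacent-admissible (inj₁ refl) (inj₂ refl) x≢d xd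
  ... | no _   | no _   | yes yc | _      = y , c , adjacent-admissible (inj₂ refl) (inj₁ refl) y≢c yc
  ... | no _   | no _   | no _   | yes yd = y , d , adjacent-admissible (inj₂ refl) (inj₂ refl) y≢d yd
  ... | no ¬xc | no ¬xd | no ¬yc | no _   =
    x , c , (inj₁ refl , x≢c , inj₂ (¬xc , ¬yc)) ,
            (inj₁ refl , (λ c≡x → x≢c (sym c≡x)) , inj₂ (¬adj-sym ¬xc , ¬adj-sym ¬xd))

  infixl 6 _⊕ᴳ_
  _⊕ᴳ_ : ∀ {m} → Fin (suc m) → ℕ → Fin (suc m)
  _⊕ᴳ_ = _⊕_ G

  module _ {m : ℕ} where
    open ≡-Reasoning

    toℕ-⊕ : (i : Fin (suc m)) (j : ℕ) → toℕ (i ⊕ᴳ j) ≡ (toℕ i + j) % suc m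
    toℕ-⊕ i j = toℕ-fromℕ< _

    ⊕-identityʳ : (i : Fin (suc m)) → i ⊕ᴳ 0 ≡ i
    ⊕-identityʳ i = toℕ-injective (begin
      toℕ (i ⊕ᴳ 0)          ≡⟨ toℕ-⊕ i 0 ⟩
      (toℕ i + 0) % suc m  ≡⟨ cong (_% suc m) (+-identityʳ (toℕ i)) ⟩
      toℕ i % suc m        ≡⟨ m<n⇒m%n≡m (toℕ<n i) ⟩
      toℕ i                ∎)

    ⊕-assoc : (i : Fin (suc m)) (a b : ℕ) → i ⊕ᴳ a ⊕ᴳ b ≡ i ⊕ᴳ (a + b)
    ⊕-assoc i a b = toℕ-injective (begin
      toℕ (i ⊕ᴳ a ⊕ᴳ b)                           ≡⟨ toℕ-⊕ (i ⊕ᴳ a) b ⟩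
      (toℕ (i ⊕ᴳ a) + b) % M                      ≡⟨ cong (λ r → (r + b) % M) (toℕ-⊕ i a) ⟩
      ((toℕ i + a) % M + b) % M                  ≡⟨ %-distribˡ-+ ((toℕ i + a) % M) b M ⟩
      ((toℕ i + a) % M % M + b % M) % M          ≡⟨ cong (λ r → (r + b % M) % M) (m%n%n≡m%n (toℕ i + a) M) ⟩
      ((toℕ i + a) % M + b % M) % M              ≡⟨ %-distribˡ-+ (toℕ i + a) b M ⟨
      (toℕ i + a + b) % M                        ≡⟨ cong (_% M) (+-assoc (toℕ i) a b) ⟩
      (toℕ i + (a + b)) % M                      ≡⟨ toℕ-⊕ i (a + b) ⟨
      toℕ (i ⊕ᴳ (a + b))                          ∎)
      where M = suc m

    ⊕-period : (i : Fin (suc m)) (j : ℕ) → i ⊕ᴳ (j + suc m) ≡ i ⊕ᴳ j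
    ⊕-period i j = toℕ-injective (begin
      toℕ (i ⊕ᴳ (j + suc m))          ≡⟨ toℕ-⊕ i (j + suc m) ⟩
      (toℕ i + (j + suc m)) % suc m  ≡⟨ cong (_% suc m) (+-assoc (toℕ i) j (suc m)) ⟨
      (toℕ i + j + suc m) % suc m    ≡⟨ [m+n]%n≡m%n (toℕ i + j) (suc m) ⟩
      (toℕ i + j) % suc m            ≡⟨ toℕ-⊕ i j ⟨
      toℕ (i ⊕ᴳ j)                    ∎)

  module _ {k : ℕ} (i : Fin (suc (2 * k))) where

    open ≡-Reasoning

    ⊕-half-back : i ⊕ᴳ suc k ⊕ᴳ k ≡ i
    ⊕-half-back = begin
      i ⊕ᴳ suc k ⊕ᴳ k          ≡⟨ ⊕-assoc i (suc k) k ⟩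
      i ⊕ᴳ (suc k + k)         ≡⟨ cong (i ⊕ᴳ_) (k+1+k≡0+M k) ⟩
      i ⊕ᴳ (0 + suc (2 * k))   ≡⟨ ⊕-period i 0 ⟩
      i ⊕ᴳ 0                   ≡⟨ ⊕-identityʳ i ⟩
      i                        ∎
      where
      k+1+k≡0+M : ∀ k → suc k + k ≡ 0 + suc (2 * k)
      k+1+k≡0+M = solve-∀

    ⊕-half-twice : i ⊕ᴳ suc k ⊕ᴳ suc k ≡ i ⊕ᴳ 1
    ⊕-half-twice = begin
      i ⊕ᴳ suc k ⊕ᴳ suc k        ≡⟨ ⊕-assoc i (suc k) (suc k) ⟩
      i ⊕ᴳ (suc k + suc k)       ≡⟨ cong (i ⊕ᴳ_) (k+1+k+1≡1+M k) ⟩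
      i ⊕ᴳ (1 + suc (2 * k))     ≡⟨ ⊕-period i 1 ⟩
      i ⊕ᴳ 1                     ∎
      where
      k+1+k+1≡1+M : ∀ k → suc k + suc k ≡ 1 + suc (2 * k)
      k+1+k+1≡1+M = solve-∀

  module _ (A : WeakEdgeAsteroid G) where
    open WeakEdgeAsteroid A

    anchor : ∀ i → Σ[ z ∈ V G ] Admissible (edge i) z (proj₁ (edge (i ⊕ᴳ k)))
    anchor i with avoids⇒separated (head-avoided (avoid i))
    ... | x≢a , _ , y≢a , _ = admissible-exists x≢a y≢a

    rep : Fin (suc (2 * k)) → Pair
    rep i = proj₁ (anchor i) , proj₁ (edge (i ⊕ᴳ k))

    rep≢ : ∀ i → proj₁ (rep i) ≢ proj₂ (rep i)
    rep≢ i = proj₁ (proj₂ (proj₂ (anchor i)))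

    -- Walk i ends at edge i + k + 1, whose walk starts at edge i again.
    rep-twisted : ∀ i → Chain G (rep i) (swap (rep (i ⊕ᴳ suc k)))
    rep-twisted i with crossing-pair (avoids⇒separated (last-avoided (avoid i)))
    ... | z , z' , adm , adm' =
      chain-trans (walk-linked (isEdge i) (avoid i) (inj₁ refl) (proj₁ adm') (proj₂ (anchor i)) adm)
                  (chain-swap (head-linked (isEdge j) (avoid j) z∈ (inj₁ refl) adm' (proj₂ (anchor j))))
      where
      j : Fin (suc (2 * k))
      j = i ⊕ᴳ suc k
      z∈ : z ∈ₑ edge (j ⊕ᴳ k)
      z∈ = subst (λ l → z ∈ₑ edge l) (sym (⊕-half-back {k} i)) (proj₁ adm)

    rep-next : ∀ i → Chain G (rep i) (rep (i ⊕ᴳ 1))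
    rep-next i = subst (λ l → Chain G (rep i) (rep l)) (⊕-half-twice {k} i)
      (chain-trans (rep-twisted i) (chain-swap (rep-twisted (i ⊕ᴳ suc k))))

    rep-linked : ∀ n i → Chain G (rep i) (rep (i ⊕ᴳ n))
    rep-linked zero i =
      subst (λ l → Chain G (rep i) (rep l)) (sym (⊕-identityʳ i)) (done (rep≢ i))
    rep-linked (suc n) i =
      chain-trans (rep-next i)
        (subst (λ l → Chain G (rep (i ⊕ᴳ 1)) (rep l)) (⊕-assoc i 1 n) (rep-linked n (i ⊕ᴳ 1)))

    asteroid⇒invertible : HasInvertiblePair G
    asteroid⇒invertible = _ , _ , rep≢ fzero ,
      chain-trans (rep-twisted fzero) (chain-swap (chain-sym (rep-linked (suc k) fzero)))

  Step : Pair → Pair → Set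
  Step (u , v) (u' , v') = u ≢ v × Adj u u' × Adj v v' × ¬ Adj u v' × ¬ Adj v u'

  step-swap : ∀ {p q} → Step p q → Step (swap p) (swap q)
  step-swap (u≢v , uu' , vv' , ¬uv' , ¬vu') = (λ v≡u → u≢v (sym v≡u)) , vv' , uu' , ¬vu' , ¬uv'

  record Steps (p q : Pair) : Set where
    field
      len    : ℕ
      point  : ℕ → Pair
      starts : point 0 ≡ p
      ends   : point len ≡ q
      steps  : ∀ r → r < len → Step (point r) (point (suc r))

  chain⇒steps : ∀ {p q} → Chain G p q → Steps p q
  chain⇒steps {p} (done _) =
    record { len = 0 ; point = λ _ → p ; starts = refl ; ends = refl ; steps = λ _ () }
  chain⇒steps (step _ _ _ (inj₁ (refl , refl)) c) = chain⇒steps c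
  chain⇒steps {p} (step u≢v _ _ (inj₂ l) c) =
    record { len = suc len ; point = point′ ; starts = refl ; ends = ends ; steps = steps′ }
    where
    open Steps (chain⇒steps c)
    point′ : ℕ → Pair
    point′ zero = p
    point′ (suc r) = point r
    steps′ : ∀ r → r < suc len → Step (point′ r) (point′ (suc r))
    steps′ zero _ = subst (Step p) (sym starts) (u≢v , l)
    steps′ (suc r) (s≤s r<len) = steps r r<len

  record AntiperiodicWalk (T : ℕ) : Set where
    field
      point        : ℕ → Pair
      antiperiodic : ∀ s → point (s + T) ≡ swap (point s)
      steps        : ∀ s → Step (point s) (point (suc s))

  module Unroll {T₀ : ℕ} (P : ℕ → Pair) (P-twist : P (suc T₀) ≡ swap (P 0))
                (P-steps : ∀ r → r < suc T₀ → Step (P r) (P (suc r))) where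

    T : ℕ
    T = suc T₀

    -- The s-th pair of the unrolled walk is P r, swapped iff b, where (r , b) = phase s.
    orient : ℕ × Bool → Pair
    orient (r , b) = if b then swap (P r) else P r

    next : ℕ × Bool → ℕ × Bool
    next (r , b) with suc r <? T
    ... | yes _ = suc r , b
    ... | no _  = 0 , not b

    phase : ℕ → ℕ × Bool
    phase zero = 0 , false
    phase (suc s) = next (phase s)

    next-< : ∀ c → proj₁ (next c) < T
    next-< (r , b) with suc r <? T
    ... | yes r+1<T = r+1<T
    ... | no _      = s≤s z≤n

    phase-< : ∀ s → proj₁ (phase s) < T
    phase-< zero = s≤s z≤n
    phase-< (suc s) = next-< (phase s)

    orient-step : ∀ b {p q} → Step p q → Step (if b then swap p else p) (if b then swap q else q)
    orient-step false st = st
    orient-step true st = step-swap st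

    orient-twist : ∀ b {p q} → Step p (swap q) → Step (if b then swap p else p) (if not b then swap q else q)
    orient-twist false st = st
    orient-twist true st = step-swap st

    next-step : ∀ c → proj₁ c < T → Step (orient c) (orient (next c))
    next-step (r , b) r<T with suc r <? T
    ... | yes _ = orient-step b (P-steps r r<T)
    ... | no r+1≮T = orient-twist b (subst (Step (P r)) (trans (cong P r+1≡T) P-twist) (P-steps r r<T))
      where
      r+1≡T : suc r ≡ T
      r+1≡T = ≤-antisym r<T (≮⇒≥ r+1≮T)

    phase-below : ∀ s → s < T → phase s ≡ (s , false)
    phase-below zero _ = refl
    phase-below (suc s) s+1<T rewrite phase-below s (<⇒≤ s+1<T) with suc s <? T
    ... | yes _      = refl
    ... | no s+1≮T = ⊥-elim (s+1≮T s+1<T)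

    phase-T : phase T ≡ (0 , true)
    phase-T rewrite phase-below T₀ (n<1+n T₀) with suc T₀ <? T
    ... | yes T<T = ⊥-elim (<-irrefl refl T<T)
    ... | no _    = refl

    next-flip : ∀ c → next (map₂ not c) ≡ map₂ not (next c)
    next-flip (r , b) with suc r <? T
    ... | yes _ = refl
    ... | no _  = refl

    phase-shift : ∀ s → phase (s + T) ≡ map₂ not (phase s)
    phase-shift zero = phase-T
    phase-shift (suc s) = trans (cong next (phase-shift s)) (next-flip (phase s))

    orient-flip : ∀ c → orient (map₂ not c) ≡ swap (orient c)
    orient-flip (r , false) = refl
    orient-flip (r , true) = refl

    unrolled : AntiperiodicWalk T
    unrolled = record
      { point        = λ s → orient (phase s)
      ; antiperiodic = λ s → trans (cong orient (phase-shift s)) (orient-flip (phase s))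
      ; steps        = λ s → next-step (phase s) (phase-< s)
      }

  module _ {T : ℕ} (W : AntiperiodicWalk T) where
    open AntiperiodicWalk W

    private
      a : ℕ → V G
      a s = proj₁ (point s)

      ε : ℕ → Pair
      ε s = a s , a (suc s)

      M : ℕ
      M = suc (2 * T)

    ε-adj : ∀ s → Adj (a s) (a (suc s))
    ε-adj s = proj₁ (proj₂ (steps s))

    a-opposite : ∀ s → a (s + T) ≡ proj₂ (point s)
    a-opposite s = cong proj₁ (antiperiodic s)

    ε-period : ∀ s → ε (s + T + T) ≡ ε s
    ε-period s = cong₂ _,_ (a-period s) (a-period (suc s))
      where
      a-period : ∀ s → a (s + T + T) ≡ a s
      a-period s = trans (a-opposite (s + T)) (cong proj₂ (antiperiodic s))

    cross-nonadjacent : ∀ s → ¬ Adj (a s) (a (suc s + T)) × ¬ Adj (a (s + T)) (a (suc s))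
    cross-nonadjacent s with steps s
    ... | _ , _ , _ , ¬ab′ , ¬ba′ =
      subst (λ w → ¬ Adj (a s) w) (sym (a-opposite (suc s))) ¬ab′ ,
      subst (λ w → ¬ Adj w (a (suc s))) (sym (a-opposite s)) ¬ba′

    avoids-opposite : ∀ s → Avoids G (ε s) (ε (s + T))
    avoids-opposite s = separated⇒avoids (separated-of-¬diagonals (ε-adj s) (ε-adj (s + T))
      (proj₁ (cross-nonadjacent s)) (¬adj-sym (proj₂ (cross-nonadjacent s))))

    avoids-next : ∀ s → Avoids G (ε s) (ε (suc s + T))
    avoids-next s = separated⇒avoids (separated-of-¬parallels (ε-adj s) (ε-adj (suc s + T))
      (proj₁ (cross-nonadjacent s)) (proj₁ (cross-nonadjacent (suc s))))

    avoids-previous : ∀ s → Avoids G (ε (suc s)) (ε (s + T))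
    avoids-previous s = separated⇒avoids (separated-of-¬parallels (ε-adj (suc s)) (ε-adj (s + T))
      (¬adj-sym (proj₂ (cross-nonadjacent s))) (¬adj-sym (proj₂ (cross-nonadjacent (suc s)))))

    walk-below : ∀ s → WalkAvoiding G (ε s) (ε (s + T)) (ε (suc s + T))
    walk-below s = more (ε-adj (s + T)) (avoids-opposite s) (one (ε-adj (suc s + T)) (avoids-next s))

    walk-middle : WalkAvoiding G (ε T) (ε (T + T)) (ε 0)
    walk-middle = subst (WalkAvoiding G (ε T) (ε (T + T))) (ε-period 0)
      (one (ε-adj (T + T)) (avoids-opposite T))

    walk-above : ∀ s → WalkAvoiding G (ε (suc s + T)) (ε s) (ε (suc s))
    walk-above s =
      more (ε-adj s) (subst (Avoids G _) (ε-period s) (avoids-previous (s + T)))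
        (one (ε-adj (suc s)) (subst (Avoids G _) (ε-period (suc s)) (avoids-opposite (suc s + T))))

    AsteroidWalk : ℕ → Set
    AsteroidWalk s = WalkAvoiding G (ε s) (ε ((s + T) % M)) (ε ((s + suc T) % M))

    +T<M : ∀ {r} → r ≤ T → r + T < M
    +T<M {r} r≤T = s≤s (≤-trans (+-monoˡ-≤ T r≤T) (+-monoʳ-≤ T (m≤m+n T 0)))

    asteroid-walk-below : ∀ s → s < T → AsteroidWalk s
    asteroid-walk-below s s<T =
      subst₂ (WalkAvoiding G (ε s)) (cong ε (sym (m<n⇒m%n≡m (+T<M (<⇒≤ s<T))))) (cong ε (sym wrap))
        (walk-below s)
      where
      wrap : (s + suc T) % M ≡ suc s + T
      wrap = trans (cong (_% M) (+-suc s T)) (m<n⇒m%n≡m (+T<M s<T))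

    asteroid-walk-middle : AsteroidWalk T
    asteroid-walk-middle =
      subst₂ (WalkAvoiding G (ε T)) (cong ε (sym (m<n⇒m%n≡m (+T<M ≤-refl)))) (cong ε (sym wrap)) walk-middle
      where
      wrap : (T + suc T) % M ≡ 0
      wrap = trans (cong (_% M) (T+[1+T]≡M T)) (n%n≡0 M)
        where
        T+[1+T]≡M : ∀ T → T + suc T ≡ suc (2 * T)
        T+[1+T]≡M = solve-∀

    asteroid-walk-above : ∀ j → suc j + T < M → AsteroidWalk (suc j + T)
    asteroid-walk-above j bound =
      subst₂ (WalkAvoiding G (ε (suc j + T))) (cong ε (sym (wrap j j<M (shift₀ j T))))
        (cong ε (sym (wrap (suc j) j+1<M (shift₁ j T)))) (walk-above j)
      where
      j+1<M : suc j < M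
      j+1<M = ≤-<-trans (m≤m+n (suc j) T) bound
      j<M : j < M
      j<M = <-trans (n<1+n j) j+1<M
      wrap : ∀ r {n} → r < M → n ≡ r + M → n % M ≡ r
      wrap r r<M refl = trans ([m+n]%n≡m%n r M) (m<n⇒m%n≡m r<M)
      shift₀ : ∀ j T → suc j + T + T ≡ j + suc (2 * T)
      shift₀ = solve-∀
      shift₁ : ∀ j T → suc j + T + suc T ≡ suc j + suc (2 * T)
      shift₁ = solve-∀

    asteroid-walk : ∀ s → s < M → AsteroidWalk s
    asteroid-walk s s<M with <-cmp s T
    ... | tri< s<T _ _ = asteroid-walk-below s s<T
    ... | tri≈ _ refl _ = asteroid-walk-middle
    ... | tri> _ _ T<s = subst AsteroidWalk j+1+T≡s (asteroid-walk-above j (subst (_< M) (sym j+1+T≡s) s<M))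
      where
      j : ℕ
      j = s ∸ suc T
      j+1+T≡s : suc j + T ≡ s
      j+1+T≡s = trans (sym (+-suc j T)) (m∸n+n≡m T<s)

    antiperiodic⇒asteroid : WeakEdgeAsteroid G
    antiperiodic⇒asteroid = record
      { k      = T
      ; edge   = λ i → ε (toℕ i)
      ; isEdge = λ i → ε-adj (toℕ i)
      ; avoid  = λ i → subst₂ (WalkAvoiding G (ε (toℕ i)))
                   (cong ε (sym (toℕ-⊕ i T))) (cong ε (sym (toℕ-⊕ i (suc T))))
                   (asteroid-walk (toℕ i) (toℕ<n i))
      }

  invertible⇒asteroid : HasInvertiblePair G → WeakEdgeAsteroid G
  invertible⇒asteroid (u , v , u≢v , c) with chain⇒steps c
  ... | record { len = zero ; starts = starts ; ends = ends } =
    ⊥-elim (u≢v (cong proj₂ (trans (sym ends) starts)))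
  ... | record { len = suc _ ; point = P ; starts = starts ; ends = ends ; steps = steps } =
    antiperiodic⇒asteroid (Unroll.unrolled P (trans ends (cong swap (sym starts))) steps)

theorem6 : (G : ReflGraph) →
    (HasInvertiblePair G → HasWeakEdgeAsteroid G) ×
    (HasWeakEdgeAsteroid G → HasInvertiblePair G)
theorem6 G = invertible⇒asteroid G , asteroid⇒invertible G
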